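{- Let $S$ be a Kleene relation algebra satisfying the Tarski rule and let $\mathsf{Z}, \mathsf{S} \in S$ be such that $\mathsf{Z}$ is a point, $\mathsf{S}$ is an injective mapping, and $(\mathsf{S}^T)^* \cdot \mathsf{Z} = \top$. Then $\mathsf{S} \sqcap \overline{\mathsf{Z}^T} = \mathsf{S} \sqcap \overline{\mathsf{S}\cdot\mathsf{Z}}$.
   Context: A Kleene relation algebra is a structure $(S,\sqcup,\sqcap,\cdot,\overline{\phantom{x}},{}^T,{}^*,\bot,\top,1)$ such that $(S,\sqcup,\sqcap,\overline{\phantom{x}},\bot,\top)$ is a Boolean algebra with order $x \sqsubseteq y \iff x \sqcup y = y$; $(S,\sqcup,\cdot,\bot,1)$ is an idempotent semiring ($\cdot$ associative with two-sided unit $1$, distributing over $\sqcup$, $\bot$ a two-sided zero of $\cdot$); transposition satisfies $(x\sqcup y)^T = x^T \sqcup y^T$, $(x^T)^T = x$, $(x\cdot y)^T = y^T\cdot x^T$ and $(x\cdot y)\sqcap z \sqsubseteq x\cdot(y\sqcap(x^T\cdot z))$; and the star satisfies $1\sqcup y\cdot y^* = y^* = 1 \sqcup y^*\cdot y$, $z\sqcup y\cdot x\sqsubseteq x \Rightarrow y^*\cdot z\sqsubseteq x$, $z \sqcup x\cdot y \sqsubseteq x \Rightarrow z\cdot y^*\sqsubseteq x$. The Tarski rule states $\top\cdot x\cdot\top = \top$ for every $x \neq \bot$. An element $x$ is univalent if $x^T x\sqsubseteq 1$, total if $1\sqsubseteq x x^T$, a mapping if univalent and total, injective if $x x^T\sqsubseteq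 1$, surjective if $1\sqsubseteq x^T x$, a vector if $x\cdot\top = x$, and a point if it is an injective surjective vector. -}

module Defs where

open import Level using (Level; suc)
open import Relation.Binary.PropositionalEquality using (_≡_)
open import Relation.Nullary using (¬_)

record KleeneRelationAlgebra (ℓ : Level) : Set (suc ℓ) where
  infixl 6 _⊔_
  infixl 7 _⊓_
  infixl 8 _·_
  infix 4 _⊑_
  field
    Carrier : Set ℓ
    _⊔_ _⊓_ _·_ : Carrier → Carrier → Carrier
    ‾ : Carrier → Carrier
    _ᵀ : Carrier → Carrier
    _* : Carrier → Carrier
    ⊥ ⊤ 𝟏 : Carrier

  _⊑_ : Carrier → Carrier → Set ℓ
  x ⊑ y = x ⊔ y ≡ y

  field
    ⊔-assoc : ∀ x y z → (x ⊔ y) ⊔ z ≡ x ⊔ (y ⊔ z)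
    ⊔-comm : ∀ x y → x ⊔ y ≡ y ⊔ x
    ⊓-assoc : ∀ x y z → (x ⊓ y) ⊓ z ≡ x ⊓ (y ⊓ z)
    ⊓-comm : ∀ x y → x ⊓ y ≡ y ⊓ x
    ⊔-absorbs-⊓ : ∀ x y → x ⊔ (x ⊓ y) ≡ x
    ⊓-absorbs-⊔ : ∀ x y → x ⊓ (x ⊔ y) ≡ x
    ⊓-distrib-⊔ : ∀ x y z → x ⊓ (y ⊔ z) ≡ (x ⊓ y) ⊔ (x ⊓ z)
    ⊔-identity : ∀ x → x ⊔ ⊥ ≡ x
    ⊓-identity : ∀ x → x ⊓ ⊤ ≡ x
    ⊔-complement : ∀ x → x ⊔ ‾ x ≡ ⊤
    ⊓-complement : ∀ x → x ⊓ ‾ x ≡ ⊥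
    ⊔-idem : ∀ x → x ⊔ x ≡ x
    ·-assoc : ∀ x y z → (x · y) · z ≡ x · (y · z)
    ·-identityˡ : ∀ x → 𝟏 · x ≡ x
    ·-identityʳ : ∀ x → x · 𝟏 ≡ x
    ·-distribˡ-⊔ : ∀ x y z → x · (y ⊔ z) ≡ x · y ⊔ x · z
    ·-distribʳ-⊔ : ∀ x y z → (y ⊔ z) · x ≡ y · x ⊔ z · x
    ·-zeroˡ : ∀ x → ⊥ · x ≡ ⊥
    ·-zeroʳ : ∀ x → x · ⊥ ≡ ⊥
    ᵀ-⊔ : ∀ x y → (x ⊔ y) ᵀ ≡ x ᵀ ⊔ y ᵀ
    ᵀ-invol : ∀ x → (x ᵀ) ᵀ ≡ x
    ᵀ-· : ∀ x y → (x · y) ᵀ ≡ y ᵀ · x ᵀ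
    dedekind : ∀ x y z → (x · y) ⊓ z ⊑ x · (y ⊓ (x ᵀ · z))
    star-unfoldˡ : ∀ y → 𝟏 ⊔ y · (y *) ≡ y *
    star-unfoldʳ : ∀ y → 𝟏 ⊔ (y *) · y ≡ y *
    star-inductˡ : ∀ x y z → z ⊔ y · x ⊑ x → (y *) · z ⊑ x
    star-inductʳ : ∀ x y z → z ⊔ x · y ⊑ x → z · (y *) ⊑ x

  TarskiRule : Set ℓ
  TarskiRule = ∀ x → ¬ (x ≡ ⊥) → ⊤ · x · ⊤ ≡ ⊤

  univalent total mapping injective surjective vector point : Carrier → Set ℓ
  univalent x = x ᵀ · x ⊑ 𝟏
  total x = 𝟏 ⊑ x · x ᵀ
  mapping x = univalent x × total x
    where open import Data.Product using (_×_)
  injective x = x · x ᵀ ⊑ 𝟏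
  surjective x = 𝟏 ⊑ x ᵀ · x
  vector x = x · ⊤ ≡ x
  point x = injective x × surjective x × vector x
    where open import Data.Product using (_×_)

-- It suffices that S ⊓ Zᵀ = S ⊓ S·Z, since complements relative to S then agree. For every S,
-- the Dedekind rule gives x ⊑ x·xᵀ·x, and with x = S ⊓ Zᵀ this yields x ⊑ S·Z·⊤ = S·Z.
-- Conversely S ⊓ S·Z ⊑ S·(Z ⊓ Sᵀ·S) ⊑ S·(Z ⊓ 𝟏) by Dedekind and univalence; a vector satisfies
-- Z ⊓ 𝟏 ⊑ Zᵀ, and S·Zᵀ ⊑ ⊤·Zᵀ = Zᵀ.
{-# OPTIONS --safe #-}
module Submission where

open import Defs
open import Level using (Level)
open import Data.Product using (_,_)
open import Relation.Binary.PropositionalEquality using (_≡_; refl; sym; trans; cong; isEquivalence; module ≡-Reasoning)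
open import Relation.Binary.Structures using (IsPreorder)
open import Relation.Binary.Reasoning.Syntax using (module ⊑-syntax)

module RelationAlgebraProperties {ℓ : Level} (A : KleeneRelationAlgebra ℓ) where
  open KleeneRelationAlgebra A

  ⊑-reflexive : ∀ {x y} → x ≡ y → x ⊑ y
  ⊑-reflexive {x} refl = ⊔-idem x

  ⊑-trans : ∀ {x y z} → x ⊑ y → y ⊑ z → x ⊑ z
  ⊑-trans {x} {y} {z} x⊑y y⊑z = begin
    x ⊔ z        ≡⟨ cong (x ⊔_) (sym y⊑z) ⟩
    x ⊔ (y ⊔ z)  ≡⟨ sym (⊔-assoc x y z) ⟩
    (x ⊔ y) ⊔ z  ≡⟨ cong (_⊔ z) x⊑y ⟩
    y ⊔ z        ≡⟨ y⊑z ⟩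
    z            ∎
    where open ≡-Reasoning

  ⊑-antisym : ∀ {x y} → x ⊑ y → y ⊑ x → x ≡ y
  ⊑-antisym {x} {y} x⊑y y⊑x = trans (sym y⊑x) (trans (⊔-comm y x) x⊑y)

  ⊑-isPreorder : IsPreorder _≡_ _⊑_
  ⊑-isPreorder = record
    { isEquivalence = isEquivalence
    ; reflexive     = ⊑-reflexive
    ; trans         = ⊑-trans
    }

  module ⊑-Reasoning where
    open import Relation.Binary.Reasoning.Base.Double ⊑-isPreorder public
      hiding (step-≲; step-∼)
    open ⊑-syntax _IsRelatedTo_ _IsRelatedTo_ ≲-go public

  ⊓-idem : ∀ x → x ⊓ x ≡ x
  ⊓-idem x = trans (cong (x ⊓_) (sym (⊔-absorbs-⊓ x x))) (⊓-absorbs-⊔ x (x ⊓ x))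

  ⊑⇒⊓≡ : ∀ {x y} → x ⊑ y → x ⊓ y ≡ x
  ⊑⇒⊓≡ {x} {y} x⊑y = trans (cong (x ⊓_) (sym x⊑y)) (⊓-absorbs-⊔ x y)

  ⊓≡⇒⊑ : ∀ {x y} → x ⊓ y ≡ x → x ⊑ y
  ⊓≡⇒⊑ {x} {y} x⊓y≡x = begin
    x ⊔ y        ≡⟨ cong (_⊔ y) (sym x⊓y≡x) ⟩
    (x ⊓ y) ⊔ y  ≡⟨ ⊔-comm (x ⊓ y) y ⟩
    y ⊔ (x ⊓ y)  ≡⟨ cong (y ⊔_) (⊓-comm x y) ⟩
    y ⊔ (y ⊓ x)  ≡⟨ ⊔-absorbs-⊓ y x ⟩
    y            ∎
    where open ≡-Reasoning

  x⊓y⊑x : ∀ x y → x ⊓ y ⊑ x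
  x⊓y⊑x x y = ⊓≡⇒⊑ (begin
    (x ⊓ y) ⊓ x  ≡⟨ ⊓-comm (x ⊓ y) x ⟩
    x ⊓ (x ⊓ y)  ≡⟨ sym (⊓-assoc x x y) ⟩
    (x ⊓ x) ⊓ y  ≡⟨ cong (_⊓ y) (⊓-idem x) ⟩
    x ⊓ y        ∎)
    where open ≡-Reasoning

  x⊓y⊑y : ∀ x y → x ⊓ y ⊑ y
  x⊓y⊑y x y = ⊓≡⇒⊑ (trans (⊓-assoc x y y) (cong (x ⊓_) (⊓-idem y)))

  ⊓-greatest : ∀ {x y z} → z ⊑ x → z ⊑ y → z ⊑ x ⊓ y
  ⊓-greatest {x} {y} {z} z⊑x z⊑y = ⊓≡⇒⊑ (begin
    z ⊓ (x ⊓ y)  ≡⟨ sym (⊓-assoc z x y) ⟩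
    (z ⊓ x) ⊓ y  ≡⟨ cong (_⊓ y) (⊑⇒⊓≡ z⊑x) ⟩
    z ⊓ y        ≡⟨ ⊑⇒⊓≡ z⊑y ⟩
    z            ∎)
    where open ≡-Reasoning

  ⊥⊑x : ∀ x → ⊥ ⊑ x
  ⊥⊑x x = trans (⊔-comm ⊥ x) (⊔-identity x)

  x⊑⊤ : ∀ x → x ⊑ ⊤
  x⊑⊤ x = begin
    x ⊔ ⊤          ≡⟨ cong (x ⊔_) (sym (⊔-complement x)) ⟩
    x ⊔ (x ⊔ ‾ x)  ≡⟨ sym (⊔-assoc x x (‾ x)) ⟩
    (x ⊔ x) ⊔ ‾ x  ≡⟨ cong (_⊔ ‾ x) (⊔-idem x) ⟩
    x ⊔ ‾ x        ≡⟨ ⊔-complement x ⟩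
    ⊤              ∎
    where open ≡-Reasoning

  x⊓y≡⊥⇒x⊑‾y : ∀ {x y} → x ⊓ y ≡ ⊥ → x ⊑ ‾ y
  x⊓y≡⊥⇒x⊑‾y {x} {y} x⊓y≡⊥ = ⊓≡⇒⊑ (sym (begin
    x                    ≡⟨ sym (⊓-identity x) ⟩
    x ⊓ ⊤                ≡⟨ cong (x ⊓_) (sym (⊔-complement y)) ⟩
    x ⊓ (y ⊔ ‾ y)        ≡⟨ ⊓-distrib-⊔ x y (‾ y) ⟩
    (x ⊓ y) ⊔ (x ⊓ ‾ y)  ≡⟨ cong (_⊔ (x ⊓ ‾ y)) x⊓y≡⊥ ⟩
    ⊥ ⊔ (x ⊓ ‾ y)        ≡⟨ ⊥⊑x (x ⊓ ‾ y) ⟩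
    x ⊓ ‾ y              ∎))
    where open ≡-Reasoning

  ⊓-‾-mono : ∀ {s a b} → s ⊓ a ≡ s ⊓ b → s ⊓ ‾ a ⊑ s ⊓ ‾ b
  ⊓-‾-mono {s} {a} {b} s⊓a≡s⊓b = ⊓-greatest (x⊓y⊑x s (‾ a)) (x⊓y≡⊥⇒x⊑‾y (begin
    (s ⊓ ‾ a) ⊓ b  ≡⟨ ⊓-assoc s (‾ a) b ⟩
    s ⊓ (‾ a ⊓ b)  ≡⟨ cong (s ⊓_) (⊓-comm (‾ a) b) ⟩
    s ⊓ (b ⊓ ‾ a)  ≡⟨ sym (⊓-assoc s b (‾ a)) ⟩
    (s ⊓ b) ⊓ ‾ a  ≡⟨ cong (_⊓ ‾ a) (sym s⊓a≡s⊓b) ⟩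
    (s ⊓ a) ⊓ ‾ a  ≡⟨ ⊓-assoc s a (‾ a) ⟩
    s ⊓ (a ⊓ ‾ a)  ≡⟨ cong (s ⊓_) (⊓-complement a) ⟩
    s ⊓ ⊥          ≡⟨ ⊓-comm s ⊥ ⟩
    ⊥ ⊓ s          ≡⟨ ⊑⇒⊓≡ (⊥⊑x s) ⟩
    ⊥              ∎))
    where open ≡-Reasoning

  ⊓-‾-cong : ∀ {s a b} → s ⊓ a ≡ s ⊓ b → s ⊓ ‾ a ≡ s ⊓ ‾ b
  ⊓-‾-cong s⊓a≡s⊓b = ⊑-antisym (⊓-‾-mono s⊓a≡s⊓b) (⊓-‾-mono (sym s⊓a≡s⊓b))

  ·-monoˡ-⊑ : ∀ {x y} z → x ⊑ y → x · z ⊑ y · z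
  ·-monoˡ-⊑ {x} {y} z x⊑y = trans (sym (·-distribʳ-⊔ z x y)) (cong (_· z) x⊑y)

  ·-monoʳ-⊑ : ∀ {x y} z → x ⊑ y → z · x ⊑ z · y
  ·-monoʳ-⊑ {x} {y} z x⊑y = trans (sym (·-distribˡ-⊔ z x y)) (cong (z ·_) x⊑y)

  ·-mono-⊑ : ∀ {x x′ y y′} → x ⊑ x′ → y ⊑ y′ → x · y ⊑ x′ · y′
  ·-mono-⊑ {x′ = x′} {y = y} x⊑x′ y⊑y′ = ⊑-trans (·-monoˡ-⊑ y x⊑x′) (·-monoʳ-⊑ x′ y⊑y′)

  ᵀ-mono-⊑ : ∀ {x y} → x ⊑ y → x ᵀ ⊑ y ᵀ
  ᵀ-mono-⊑ {x} {y} x⊑y = trans (sym (ᵀ-⊔ x y)) (cong _ᵀ x⊑y)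

  ⊑ᵀ⇒ᵀ⊑ : ∀ {x y} → x ⊑ y ᵀ → x ᵀ ⊑ y
  ⊑ᵀ⇒ᵀ⊑ {x} {y} x⊑yᵀ = ⊑-trans (ᵀ-mono-⊑ x⊑yᵀ) (⊑-reflexive (ᵀ-invol y))

  ᵀ⊑⇒⊑ᵀ : ∀ {x y} → x ᵀ ⊑ y → x ⊑ y ᵀ
  ᵀ⊑⇒⊑ᵀ {x} {y} xᵀ⊑y = ⊑-trans (⊑-reflexive (sym (ᵀ-invol x))) (ᵀ-mono-⊑ xᵀ⊑y)

  ⊤ᵀ≡⊤ : ⊤ ᵀ ≡ ⊤
  ⊤ᵀ≡⊤ = ⊑-antisym (x⊑⊤ (⊤ ᵀ)) (ᵀ⊑⇒⊑ᵀ (x⊑⊤ (⊤ ᵀ)))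

  x⊑x·xᵀ·x : ∀ x → x ⊑ x · x ᵀ · x
  x⊑x·xᵀ·x x = begin
    x                    ≡⟨ sym (trans (cong (_⊓ x) (·-identityʳ x)) (⊓-idem x)) ⟩
    x · 𝟏 ⊓ x            ⊑⟨ dedekind x 𝟏 x ⟩
    x · (𝟏 ⊓ x ᵀ · x)    ⊑⟨ ·-monoʳ-⊑ x (x⊓y⊑y 𝟏 (x ᵀ · x)) ⟩
    x · (x ᵀ · x)        ≡⟨ sym (·-assoc x (x ᵀ) x) ⟩
    x · x ᵀ · x          ∎
    where open ⊑-Reasoning

  ·-vector : ∀ x {v} → vector v → vector (x · v)
  ·-vector x {v} v⊤≡v = trans (·-assoc x v ⊤) (cong (x ·_) v⊤≡v)

  ⊤·vectorᵀ : ∀ {v} → vector v → ⊤ · v ᵀ ≡ v ᵀ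
  ⊤·vectorᵀ {v} v⊤≡v = begin
    ⊤ · v ᵀ    ≡⟨ cong (_· v ᵀ) (sym ⊤ᵀ≡⊤) ⟩
    ⊤ ᵀ · v ᵀ  ≡⟨ sym (ᵀ-· v ⊤) ⟩
    (v · ⊤) ᵀ  ≡⟨ cong _ᵀ v⊤≡v ⟩
    v ᵀ        ∎
    where open ≡-Reasoning

  ·vectorᵀ⊑vectorᵀ : ∀ x {v} → vector v → x · v ᵀ ⊑ v ᵀ
  ·vectorᵀ⊑vectorᵀ x {v} v⊤≡v = begin
    x · v ᵀ        ≡⟨ cong (x ·_) (sym (⊤·vectorᵀ v⊤≡v)) ⟩
    x · (⊤ · v ᵀ)  ≡⟨ sym (·-assoc x ⊤ (v ᵀ)) ⟩
    x · ⊤ · v ᵀ    ⊑⟨ ·-monoˡ-⊑ (v ᵀ) (x⊑⊤ (x · ⊤)) ⟩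
    ⊤ · v ᵀ        ≡⟨ ⊤·vectorᵀ v⊤≡v ⟩
    v ᵀ            ∎
    where open ⊑-Reasoning

  vector⊓𝟏⊑vectorᵀ : ∀ {v} → vector v → v ⊓ 𝟏 ⊑ v ᵀ
  vector⊓𝟏⊑vectorᵀ {v} v⊤≡v = begin
    w            ⊑⟨ x⊑x·xᵀ·x w ⟩
    w · w ᵀ · w  ⊑⟨ ·-mono-⊑ (·-mono-⊑ (x⊑⊤ w) (ᵀ-mono-⊑ (x⊓y⊑x v 𝟏))) (x⊓y⊑y v 𝟏) ⟩
    ⊤ · v ᵀ · 𝟏  ≡⟨ ·-identityʳ (⊤ · v ᵀ) ⟩
    ⊤ · v ᵀ      ≡⟨ ⊤·vectorᵀ v⊤≡v ⟩
    v ᵀ          ∎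
    where
    open ⊑-Reasoning
    w : Carrier
    w = v ⊓ 𝟏

  ⊓vectorᵀ⊑·vector : ∀ x {v} → vector v → x ⊓ v ᵀ ⊑ x · v
  ⊓vectorᵀ⊑·vector x {v} v⊤≡v = begin
    y            ⊑⟨ x⊑x·xᵀ·x y ⟩
    y · y ᵀ · y  ⊑⟨ ·-mono-⊑ (·-mono-⊑ (x⊓y⊑x x (v ᵀ)) (⊑ᵀ⇒ᵀ⊑ (x⊓y⊑y x (v ᵀ)))) (x⊑⊤ y) ⟩
    x · v · ⊤    ≡⟨ ·-vector x v⊤≡v ⟩
    x · v        ∎
    where
    open ⊑-Reasoning
    y : Carrier
    y = x ⊓ v ᵀ

  univalent⇒⊓·vector⊑vectorᵀ : ∀ {x v} → univalent x → vector v → x ⊓ x · v ⊑ v ᵀ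
  univalent⇒⊓·vector⊑vectorᵀ {x} {v} xᵀx⊑𝟏 v⊤≡v = begin
    x ⊓ x · v          ≡⟨ ⊓-comm x (x · v) ⟩
    x · v ⊓ x          ⊑⟨ dedekind x v x ⟩
    x · (v ⊓ x ᵀ · x)  ⊑⟨ ·-monoʳ-⊑ x v⊓xᵀx⊑v⊓𝟏 ⟩
    x · (v ⊓ 𝟏)        ⊑⟨ ·-monoʳ-⊑ x (vector⊓𝟏⊑vectorᵀ v⊤≡v) ⟩
    x · v ᵀ            ⊑⟨ ·vectorᵀ⊑vectorᵀ x v⊤≡v ⟩
    v ᵀ                ∎
    where
    open ⊑-Reasoning
    v⊓xᵀx⊑v⊓𝟏 : v ⊓ x ᵀ · x ⊑ v ⊓ 𝟏
    v⊓xᵀx⊑v⊓𝟏 = ⊓-greatest (x⊓y⊑x v (x ᵀ · x)) (⊑-trans (x⊓y⊑y v (x ᵀ · x)) xᵀx⊑𝟏)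

  univalent⇒⊓vectorᵀ≡⊓·vector : ∀ {x v} → univalent x → vector v → x ⊓ v ᵀ ≡ x ⊓ x · v
  univalent⇒⊓vectorᵀ≡⊓·vector {x} {v} x-univalent v-vector = ⊑-antisym
    (⊓-greatest (x⊓y⊑x x (v ᵀ)) (⊓vectorᵀ⊑·vector x v-vector))
    (⊓-greatest (x⊓y⊑x x (x · v)) (univalent⇒⊓·vector⊑vectorᵀ x-univalent v-vector))

theorem9p1 : ∀ {ℓ : Level} (A : KleeneRelationAlgebra ℓ) → let open KleeneRelationAlgebra A in
    TarskiRule → (Z S : Carrier) → point Z → injective S → mapping S → ((S ᵀ) *) · Z ≡ ⊤ →
    S ⊓ ‾ (Z ᵀ) ≡ S ⊓ ‾ (S · Z)
theorem9p1 A _ Z S (_ , _ , Z-vector) _ (S-univalent , _) _ =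
  ⊓-‾-cong (univalent⇒⊓vectorᵀ≡⊓·vector S-univalent Z-vector)
  where open RelationAlgebraProperties A
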